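{- Let $G$ be a finite simple graph and $A_1,A_2$ two disjoint solvable subsets of $V(G)$. Then: (i) if $A_1$ and $A_2$ are both AO or both NO, then $A_1$ is $\overline{\mathbf{x}_{A_2}}$-NO if and only if $A_2$ is $\overline{\mathbf{x}_{A_1}}$-NO; (ii) if $A_1$ is AO and $A_2$ is NO, then $A_1$ is $\overline{\mathbf{x}_{A_2}}$-NO if and only if $A_2$ is $\overline{\mathbf{x}_{A_1}}$-AO.
   Context: For $G$ with vertex set $V=\{v_1,\dots,v_n\}$, $N=N(G)$ is the closed neighborhood matrix over $\mathbb{Z}_2$ (entry $(i,j)$ is $1$ iff $i=j$ or $v_iv_j$ is an edge). Subsets $A\subseteq V$ are identified with characteristic vectors $\mathbf{x}_A$; $\mathbf{x}\cdot\mathbf{y}=\mathbf{x}^t\mathbf{y}$ over $\mathbb{Z}_2$; $\mathbf{1}$ is the all-ones vector and $\overline{\mathbf{x}}:=\mathbf{x}+\mathbf{1}$. A pattern $\mathbf{p}$ solves configuration $\mathbf{c}$ if $N\mathbf{p}=\mathbf{c}$; $\mathbf{c}$ (or a set $A$, via $\mathbf{x}_A$) is solvable if some pattern solves it. Every graph has an odd dominating pattern, i.e. $\mathbf{1}$ is solvable. For a solvable set $A$ and a solvable configuration $\mathbf{c}$: $A$ is $\mathbf{c}$-AO if $\mathbf{x}_A\cdot\mathbf{p}=1$ for all solving patterns $\mathbf{p}$ of $\mathbf{c}$, and $\mathbf{c}$-NO if $\mathbf{x}_A\cdot\mathbf{p}=0$ for all solving patterns $\mathbf{p}$ of $\mathbf{c}$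 (exactly one of these holds). AO and NO mean $\mathbf{1}$-AO and $\mathbf{1}$-NO. Note $\overline{\mathbf{x}_{A_i}}$ is solvable when $A_i$ is. -}

module Defs where

open import Data.Nat using (ℕ; zero; suc)
open import Data.Fin using (Fin; zero; suc; _≟_)
open import Data.Bool using (Bool; true; false; _xor_; _∧_; _∨_; not)
open import Relation.Nullary.Decidable using (⌊_⌋)
open import Relation.Binary.PropositionalEquality using (_≡_)
open import Data.Product using (Σ; _×_)
open import Data.Empty using (⊥)

-- Vectors over ℤ₂ of length n, as functions Fin n → Bool
-- (false = 0, true = 1, addition = xor, multiplication = ∧).
Vec₂ : ℕ → Set
Vec₂ n = Fin n → Bool

Σ₂ : ∀ {n} → Vec₂ n → Bool
Σ₂ {zero}  f = false
Σ₂ {suc n} f = f zero xor Σ₂ (λ i → f (suc i))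

_·_ : ∀ {n} → Vec₂ n → Vec₂ n → Bool
x · y = Σ₂ (λ i → x i ∧ y i)

𝟏 : ∀ {n} → Vec₂ n
𝟏 _ = true

‾ : ∀ {n} → Vec₂ n → Vec₂ n
‾ x i = x i xor true

record Graph (n : ℕ) : Set where
  field
    adj     : Fin n → Fin n → Bool
    symm    : ∀ i j → adj i j ≡ adj j i
    irrefl  : ∀ i → adj i i ≡ false
open Graph public

N : ∀ {n} → Graph n → Fin n → Fin n → Bool
N G i j = ⌊ i ≟ j ⌋ ∨ adj G i j

_*ᴺ_ : ∀ {n} → (Fin n → Fin n → Bool) → Vec₂ n → Vec₂ n
(M *ᴺ p) i = Σ₂ (λ j → M i j ∧ p j)

Solves : ∀ {n} → Graph n → Vec₂ n → Vec₂ n → Set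
Solves G p c = ∀ i → (N G *ᴺ p) i ≡ c i

Solvable : ∀ {n} → Graph n → Vec₂ n → Set
Solvable G c = Σ (Vec₂ _) (λ p → Solves G p c)

-- subsets A ⊆ V identified with characteristic vectors x_A : Vec₂ n
Disjoint : ∀ {n} → Vec₂ n → Vec₂ n → Set
Disjoint a b = ∀ i → a i ∧ b i ≡ false

_is_-AO : ∀ {n} → Graph n → Vec₂ n → Vec₂ n → Set
_is_-AO G a c = ∀ p → Solves G p c → a · p ≡ true

_is_-NO : ∀ {n} → Graph n → Vec₂ n → Vec₂ n → Set
_is_-NO G a c = ∀ p → Solves G p c → a · p ≡ false

AO : ∀ {n} → Graph n → Vec₂ n → Set
AO G a = _is_-AO G a 𝟏

NO : ∀ {n} → Graph n → Vec₂ n → Set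
NO G a = _is_-NO G a 𝟏

-- Since N is symmetric, a pattern q solving a and a pattern p solving c satisfy
-- a · p = (N q) · p = q · (N p) = q · c.  So a set a is c-AO or c-NO according to the single
-- parity q · c; in particular a is AO or NO according to q · 𝟏.  With ‾ a₂ = a₂ + 𝟏 and the same
-- symmetry q₁ · a₂ = q₂ · a₁ one gets
--   q₁ · ‾ a₂ + q₂ · ‾ a₁ = q₁ · 𝟏 + q₂ · 𝟏,
-- which vanishes when a₁ and a₂ are of the same kind and is 1 when a₁ is AO and a₂ is NO.
module Submission where

open import Algebra.Bundles using (CommutativeMonoid; CommutativeRing)
open import Data.Bool using (Bool; true; false; not; _xor_; _∧_; _∨_)
open import Data.Bool.Properties
  using (∧-comm; ∧-commutativeMonoid; ∧-distribˡ-xor; xor-comm; xor-same; xor-inverseˡ;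
         not-involutive; xor-∧-commutativeRing)
open import Data.Empty using (⊥-elim)
open import Data.Fin using (Fin; zero; suc; _≟_)
open import Data.Nat using (ℕ; zero; suc)
open import Data.Product using (_×_; _,_)
open import Data.Sum using (_⊎_; inj₁; inj₂)
open import Function.Bundles using (_⇔_; mk⇔; Equivalence)
open import Function.Construct.Symmetry using (⇔-sym)
open import Function.Properties.Equivalence using (⇔-setoid)
open import Level using (0ℓ)
open import Relation.Binary.PropositionalEquality
  using (_≡_; refl; sym; trans; cong; cong₂; module ≡-Reasoning)
import Relation.Binary.Reasoning.Setoid as SetoidReasoning
open import Relation.Nullary.Decidable using (⌊_⌋; yes; no)
open import Algebra.Properties.CommutativeSemigroup (CommutativeMonoid.commutativeSemigroup ∧-commutativeMonoid)
  using (x∙yz≈z∙yx)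
open import Algebra.Properties.Semiring.Sum (CommutativeRing.semiring xor-∧-commutativeRing)
  using (sum; ∑-distrib-+; ∑-comm; *-distribˡ-sum)

open import Defs

-- Σ₂ is the summation of the Boolean ring (xor, ∧), whose library lemmas are thus available.
Σ₂≡sum : ∀ {n} (f : Vec₂ n) → Σ₂ f ≡ sum f
Σ₂≡sum {zero}  f = refl
Σ₂≡sum {suc n} f = cong (f zero xor_) (Σ₂≡sum (λ i → f (suc i)))

Σ₂-cong : ∀ {n} {f g : Vec₂ n} → (∀ i → f i ≡ g i) → Σ₂ f ≡ Σ₂ g
Σ₂-cong {zero}  f≗g = refl
Σ₂-cong {suc n} f≗g = cong₂ _xor_ (f≗g zero) (Σ₂-cong (λ i → f≗g (suc i)))

Σ₂-distrib-xor : ∀ {n} (f g : Vec₂ n) → Σ₂ (λ i → f i xor g i) ≡ Σ₂ f xor Σ₂ g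
Σ₂-distrib-xor f g = begin
  Σ₂ (λ i → f i xor g i) ≡⟨ Σ₂≡sum (λ i → f i xor g i) ⟩
  sum (λ i → f i xor g i) ≡⟨ ∑-distrib-+ f g ⟩
  sum f xor sum g         ≡⟨ cong₂ _xor_ (Σ₂≡sum f) (Σ₂≡sum g) ⟨
  Σ₂ f xor Σ₂ g           ∎
  where open ≡-Reasoning

∧-distribˡ-Σ₂ : ∀ {n} x (f : Vec₂ n) → x ∧ Σ₂ f ≡ Σ₂ (λ i → x ∧ f i)
∧-distribˡ-Σ₂ x f = begin
  x ∧ Σ₂ f             ≡⟨ cong (x ∧_) (Σ₂≡sum f) ⟩
  x ∧ sum f            ≡⟨ *-distribˡ-sum x f ⟩
  sum (λ i → x ∧ f i)  ≡⟨ Σ₂≡sum (λ i → x ∧ f i) ⟨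
  Σ₂ (λ i → x ∧ f i)   ∎
  where open ≡-Reasoning

Σ₂-comm : ∀ {m n} (f : Fin m → Fin n → Bool) →
  Σ₂ (λ i → Σ₂ (λ j → f i j)) ≡ Σ₂ (λ j → Σ₂ (λ i → f i j))
Σ₂-comm f = begin
  Σ₂ (λ i → Σ₂ (λ j → f i j))    ≡⟨ Σ₂-cong (λ i → Σ₂≡sum (f i)) ⟩
  Σ₂ (λ i → sum (λ j → f i j))   ≡⟨ Σ₂≡sum (λ i → sum (f i)) ⟩
  sum (λ i → sum (λ j → f i j))  ≡⟨ ∑-comm f ⟩
  sum (λ j → sum (λ i → f i j))  ≡⟨ Σ₂≡sum (λ j → sum (λ i → f i j)) ⟨
  Σ₂ (λ j → sum (λ i → f i j))   ≡⟨ Σ₂-cong (λ j → Σ₂≡sum (λ i → f i j)) ⟨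
  Σ₂ (λ j → Σ₂ (λ i → f i j))    ∎
  where open ≡-Reasoning

_⊕_ : ∀ {n} → Vec₂ n → Vec₂ n → Vec₂ n
(x ⊕ y) i = x i xor y i

·-comm : ∀ {n} (x y : Vec₂ n) → x · y ≡ y · x
·-comm x y = Σ₂-cong (λ i → ∧-comm (x i) (y i))

·-distribˡ-⊕ : ∀ {n} (x y z : Vec₂ n) → x · (y ⊕ z) ≡ x · y xor x · z
·-distribˡ-⊕ x y z =
  trans (Σ₂-cong (λ i → ∧-distribˡ-xor (x i) (y i) (z i)))
        (Σ₂-distrib-xor (λ i → x i ∧ y i) (λ i → x i ∧ z i))

*ᴺ-distribˡ-⊕ : ∀ {n} (M : Fin n → Fin n → Bool) (p r : Vec₂ n) i →
  (M *ᴺ (p ⊕ r)) i ≡ (M *ᴺ p) i xor (M *ᴺ r) i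
*ᴺ-distribˡ-⊕ M p r i =
  trans (Σ₂-cong (λ j → ∧-distribˡ-xor (M i j) (p j) (r j)))
        (Σ₂-distrib-xor (λ j → M i j ∧ p j) (λ j → M i j ∧ r j))

*ᴺ-selfAdjoint : ∀ {n} (M : Fin n → Fin n → Bool) → (∀ i j → M i j ≡ M j i) →
  ∀ q p → (M *ᴺ q) · p ≡ q · (M *ᴺ p)
*ᴺ-selfAdjoint M M-sym q p = begin
  Σ₂ (λ i → Σ₂ (λ j → M i j ∧ q j) ∧ p i)    ≡⟨ Σ₂-cong (λ i → ∧-comm _ (p i)) ⟩
  Σ₂ (λ i → p i ∧ Σ₂ (λ j → M i j ∧ q j))    ≡⟨ Σ₂-cong (λ i → ∧-distribˡ-Σ₂ (p i) (λ j → M i j ∧ q j)) ⟩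
  Σ₂ (λ i → Σ₂ (λ j → p i ∧ (M i j ∧ q j)))  ≡⟨ Σ₂-comm (λ i j → p i ∧ (M i j ∧ q j)) ⟩
  Σ₂ (λ j → Σ₂ (λ i → p i ∧ (M i j ∧ q j)))  ≡⟨ Σ₂-cong (λ j → Σ₂-cong (λ i → swap i j)) ⟩
  Σ₂ (λ j → Σ₂ (λ i → q j ∧ (M j i ∧ p i)))  ≡⟨ Σ₂-cong (λ j → ∧-distribˡ-Σ₂ (q j) (λ i → M j i ∧ p i)) ⟨
  Σ₂ (λ j → q j ∧ Σ₂ (λ i → M j i ∧ p i))    ∎
  where
  open ≡-Reasoning
  swap : ∀ i j → p i ∧ (M i j ∧ q j) ≡ q j ∧ (M j i ∧ p i)
  swap i j = trans (x∙yz≈z∙yx (p i) (M i j) (q j)) (cong (λ m → q j ∧ (m ∧ p i)) (M-sym i j))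

⌊≟⌋-sym : ∀ {n} (i j : Fin n) → ⌊ i ≟ j ⌋ ≡ ⌊ j ≟ i ⌋
⌊≟⌋-sym i j with i ≟ j | j ≟ i
... | yes _   | yes _   = refl
... | no _    | no _    = refl
... | yes i≡j | no j≢i  = ⊥-elim (j≢i (sym i≡j))
... | no i≢j  | yes j≡i = ⊥-elim (i≢j (sym j≡i))

N-sym : ∀ {n} (G : Graph n) i j → N G i j ≡ N G j i
N-sym G i j = cong₂ _∨_ (⌊≟⌋-sym i j) (symm G i j)

xor-telescope : ∀ t u v → t xor u ≡ (u xor v) xor (t xor v)
xor-telescope false false false = refl
xor-telescope false false true  = refl
xor-telescope false true  false = refl
xor-telescope false true  true  = refl
xor-telescope true  false false = refl
xor-telescope true  false true  = refl
xor-telescope true  true  false = refl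
xor-telescope true  true  true  = refl

not≡false⇔≡true : ∀ x → not x ≡ false ⇔ x ≡ true
not≡false⇔≡true x = mk⇔ (λ h → trans (sym (not-involutive x)) (cong not h)) (cong not)

module Patterns {n} (G : Graph n) where

  ·-solution : ∀ {q a p c : Vec₂ n} → Solves G q a → Solves G p c → a · p ≡ q · c
  ·-solution {q} {a} {p} {c} sq sp = begin
    a · p           ≡⟨ Σ₂-cong (λ i → cong (_∧ p i) (sq i)) ⟨
    (N G *ᴺ q) · p  ≡⟨ *ᴺ-selfAdjoint (N G) (N-sym G) q p ⟩
    q · (N G *ᴺ p)  ≡⟨ Σ₂-cong (λ i → cong (q i ∧_) (sp i)) ⟩
    q · c           ∎
    where open ≡-Reasoning

  solutions-·-sym : ∀ {q₁ a₁ q₂ a₂ : Vec₂ n} → Solves G q₁ a₁ → Solves G q₂ a₂ → q₁ · a₂ ≡ q₂ · a₁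
  solutions-·-sym {q₁} {a₂ = a₂} sq₁ sq₂ = trans (·-comm q₁ a₂) (·-solution sq₂ sq₁)

  Solves-⊕ : ∀ {p r c d : Vec₂ n} → Solves G p c → Solves G r d → Solves G (p ⊕ r) (c ⊕ d)
  Solves-⊕ {p} {r} sp sr i = trans (*ᴺ-distribˡ-⊕ (N G) p r i) (cong₂ _xor_ (sp i) (sr i))

  complement-solvable : ∀ {r b : Vec₂ n} → Solvable G 𝟏 → Solves G r b → Solvable G (‾ b)
  complement-solvable {r} (e , se) sr = r ⊕ e , Solves-⊕ sr se

  𝟏-solvable : ∀ {p r b : Vec₂ n} → Solves G p (‾ b) → Solves G r b → Solvable G 𝟏
  𝟏-solvable {p} {r} {b} sp sr = p ⊕ r , λ i → trans (Solves-⊕ sp sr i) (complement-xor (b i))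
    where
    complement-xor : ∀ x → (x xor true) xor x ≡ true
    complement-xor x = trans (cong (_xor x) (xor-comm x true)) (xor-inverseˡ x)

  is-NO⇔ : ∀ {q a c : Vec₂ n} → Solves G q a → Solvable G c → _is_-NO G a c ⇔ q · c ≡ false
  is-NO⇔ sq (p₀ , sp₀) =
    mk⇔ (λ H → trans (sym (·-solution sq sp₀)) (H p₀ sp₀)) (λ h p sp → trans (·-solution sq sp) h)

  is-AO⇔ : ∀ {q a c : Vec₂ n} → Solves G q a → Solvable G c → _is_-AO G a c ⇔ q · c ≡ true
  is-AO⇔ sq (p₀ , sp₀) =
    mk⇔ (λ H → trans (sym (·-solution sq sp₀)) (H p₀ sp₀)) (λ h p sp → trans (·-solution sq sp) h)

  complement-parity : ∀ {q₁ a₁ q₂ a₂ : Vec₂ n} → Solves G q₁ a₁ → Solves G q₂ a₂ →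
    q₁ · ‾ a₂ ≡ (q₁ · 𝟏 xor q₂ · 𝟏) xor q₂ · ‾ a₁
  complement-parity {q₁} {a₁} {q₂} {a₂} sq₁ sq₂ = begin
    q₁ · ‾ a₂                                       ≡⟨ ·-distribˡ-⊕ q₁ a₂ 𝟏 ⟩
    q₁ · a₂ xor q₁ · 𝟏                              ≡⟨ cong (_xor q₁ · 𝟏) (solutions-·-sym sq₁ sq₂) ⟩
    q₂ · a₁ xor q₁ · 𝟏                              ≡⟨ xor-telescope (q₂ · a₁) (q₁ · 𝟏) (q₂ · 𝟏) ⟩
    (q₁ · 𝟏 xor q₂ · 𝟏) xor (q₂ · a₁ xor q₂ · 𝟏)  ≡⟨ cong ((q₁ · 𝟏 xor q₂ · 𝟏) xor_) (·-distribˡ-⊕ q₂ a₁ 𝟏) ⟨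
    (q₁ · 𝟏 xor q₂ · 𝟏) xor q₂ · ‾ a₁              ∎
    where open ≡-Reasoning

  -- A solution p of ‾ b and a solution r of b give the solution p ⊕ r of 𝟏, so a comparison
  -- of properties of all solutions of ‾ a₂ and of ‾ a₁ may assume that 𝟏 is solvable.
  ⇔-assuming-𝟏-solvable : ∀ {q₁ a₁ q₂ a₂ : Vec₂ n} {P Q : Vec₂ n → Set} →
    Solves G q₁ a₁ → Solves G q₂ a₂ →
    (Solvable G 𝟏 → (∀ p → Solves G p (‾ a₂) → P p) ⇔ (∀ p → Solves G p (‾ a₁) → Q p)) →
    (∀ p → Solves G p (‾ a₂) → P p) ⇔ (∀ p → Solves G p (‾ a₁) → Q p)
  ⇔-assuming-𝟏-solvable sq₁ sq₂ k = mk⇔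
    (λ H p sp → Equivalence.to   (k (𝟏-solvable sp sq₁)) H p sp)
    (λ H p sp → Equivalence.from (k (𝟏-solvable sp sq₂)) H p sp)

  NO-‾⇔NO-‾ : ∀ {q₁ a₁ q₂ a₂ : Vec₂ n} → Solves G q₁ a₁ → Solves G q₂ a₂ → Solvable G 𝟏 →
    q₁ · 𝟏 ≡ q₂ · 𝟏 → _is_-NO G a₁ (‾ a₂) ⇔ _is_-NO G a₂ (‾ a₁)
  NO-‾⇔NO-‾ {q₁} {a₁} {q₂} {a₂} sq₁ sq₂ s𝟏 equal-parity = begin
    _is_-NO G a₁ (‾ a₂)  ≈⟨ is-NO⇔ sq₁ (complement-solvable s𝟏 sq₂) ⟩
    q₁ · ‾ a₂ ≡ false    ≡⟨ cong (_≡ false) (trans (complement-parity sq₁ sq₂)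
                                                   (cong (_xor q₂ · ‾ a₁) parities-cancel)) ⟩
    q₂ · ‾ a₁ ≡ false    ≈⟨ ⇔-sym (is-NO⇔ sq₂ (complement-solvable s𝟏 sq₁)) ⟩
    _is_-NO G a₂ (‾ a₁)  ∎
    where
    open SetoidReasoning (⇔-setoid 0ℓ)
    parities-cancel : q₁ · 𝟏 xor q₂ · 𝟏 ≡ false
    parities-cancel = trans (cong (_xor q₂ · 𝟏) equal-parity) (xor-same (q₂ · 𝟏))

  NO-‾⇔AO-‾ : ∀ {q₁ a₁ q₂ a₂ : Vec₂ n} → Solves G q₁ a₁ → Solves G q₂ a₂ → Solvable G 𝟏 →
    q₁ · 𝟏 ≡ true → q₂ · 𝟏 ≡ false → _is_-NO G a₁ (‾ a₂) ⇔ _is_-AO G a₂ (‾ a₁)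
  NO-‾⇔AO-‾ {q₁} {a₁} {q₂} {a₂} sq₁ sq₂ s𝟏 odd₁ even₂ = begin
    _is_-NO G a₁ (‾ a₂)      ≈⟨ is-NO⇔ sq₁ (complement-solvable s𝟏 sq₂) ⟩
    q₁ · ‾ a₂ ≡ false        ≡⟨ cong (_≡ false) (trans (complement-parity sq₁ sq₂)
                                                       (cong (_xor q₂ · ‾ a₁) (cong₂ _xor_ odd₁ even₂))) ⟩
    not (q₂ · ‾ a₁) ≡ false  ≈⟨ not≡false⇔≡true (q₂ · ‾ a₁) ⟩
    q₂ · ‾ a₁ ≡ true         ≈⟨ ⇔-sym (is-AO⇔ sq₂ (complement-solvable s𝟏 sq₁)) ⟩
    _is_-AO G a₂ (‾ a₁)      ∎
    where open SetoidReasoning (⇔-setoid 0ℓ)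

mainTheorem7 : ∀ {n : ℕ} (G : Graph n) (a₁ a₂ : Vec₂ n) →
    Solvable G a₁ → Solvable G a₂ → Disjoint a₁ a₂ →
    (((AO G a₁ × AO G a₂) ⊎ (NO G a₁ × NO G a₂)) →
      (_is_-NO G a₁ (‾ a₂) ⇔ _is_-NO G a₂ (‾ a₁)))
    × ((AO G a₁ × NO G a₂) →
      (_is_-NO G a₁ (‾ a₂) ⇔ _is_-AO G a₂ (‾ a₁)))
mainTheorem7 G a₁ a₂ (q₁ , sq₁) (q₂ , sq₂) _ = same-kind , AO-and-NO
  where
  open Patterns G
  same-kind : (AO G a₁ × AO G a₂) ⊎ (NO G a₁ × NO G a₂) →
    _is_-NO G a₁ (‾ a₂) ⇔ _is_-NO G a₂ (‾ a₁)
  same-kind (inj₁ (ao₁ , ao₂)) = ⇔-assuming-𝟏-solvable sq₁ sq₂ λ s𝟏 →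
    NO-‾⇔NO-‾ sq₁ sq₂ s𝟏
      (trans (Equivalence.to (is-AO⇔ sq₁ s𝟏) ao₁) (sym (Equivalence.to (is-AO⇔ sq₂ s𝟏) ao₂)))
  same-kind (inj₂ (no₁ , no₂)) = ⇔-assuming-𝟏-solvable sq₁ sq₂ λ s𝟏 →
    NO-‾⇔NO-‾ sq₁ sq₂ s𝟏
      (trans (Equivalence.to (is-NO⇔ sq₁ s𝟏) no₁) (sym (Equivalence.to (is-NO⇔ sq₂ s𝟏) no₂)))
  AO-and-NO : AO G a₁ × NO G a₂ → _is_-NO G a₁ (‾ a₂) ⇔ _is_-AO G a₂ (‾ a₁)
  AO-and-NO (ao₁ , no₂) = ⇔-assuming-𝟏-solvable sq₁ sq₂ λ s𝟏 →
    NO-‾⇔AO-‾ sq₁ sq₂ s𝟏 (Equivalence.to (is-AO⇔ sq₁ s𝟏) ao₁) (Equivalence.to (is-NO⇔ sq₂ s𝟏) no₂)
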